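{- Let $A$ be a positive integer such that $(A,A^{*})$ is an additive pair. Then $A+A^{*}$ is a palindrome.
   Context: For a positive integer $A$ with decimal representation $A=\sum_{i=0}^{a} a_i 10^i$ (digits $a_i\in\{0,\dots,9\}$, $a_a\neq0$), let $P(A,x)=\sum_{i=0}^a a_ix^i$ and let $A^{*}=\sum_{i=0}^a a_i10^{a-i}$ be its reversal; an integer $C$ is a palindrome if $C=C^{*}$. A pair $(A,B)$ of positive integers is an additive pair if $P(A,x)+P(B,x)=P(A+B,x)$. -}

module Defs where

open import Data.Nat using (ℕ; zero; suc; _+_; _*_; _^_)
open import Data.Nat.DivMod using (_/_; _%_)
open import Data.List using (List; []; _∷_; foldr; reverse)

-- little-endian decimal digits, using fuel (n steps always suffice)
digitsAux : ℕ → ℕ → List ℕ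
digitsAux zero    n = []
digitsAux (suc f) zero = []
digitsAux (suc f) n@(suc _) = (n % 10) ∷ digitsAux f (n / 10)

digits : ℕ → List ℕ
digits n = digitsAux n n

evalPoly : List ℕ → ℕ → ℕ
evalPoly cs x = foldr (λ c acc → c + x * acc) 0 cs

P : ℕ → ℕ → ℕ
P A x = evalPoly (digits A) x

-- A* = Σ a_i 10^(a-i): read the digits in reversed order
rev : ℕ → ℕ
rev A = evalPoly (reverse (digits A)) 10

IsPalindrome : ℕ → Set
IsPalindrome C = C ≡ rev C
  where open import Relation.Binary.PropositionalEquality using (_≡_)

-- (A, B) additive pair: P(A,x) + P(B,x) = P(A+B,x) as polynomials
-- (stated as equality of evaluations at every natural x, which for
--  polynomials is equivalent to equality of coefficients)
AdditivePair : ℕ → ℕ → Set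
AdditivePair A B = ∀ (x : ℕ) → P A x + P B x ≡ P (A + B) x
  where open import Relation.Binary.PropositionalEquality using (_≡_)

module Submission where

-- Let d be the decimal digit list of A (least significant
-- first), r = reverse d its reversal, and C = A + A*.  Then A* = r read in
-- base 10, and P(A*, x) = Σ r_i x^i because leading zeros of r do not
-- change the polynomial.  Evaluating the additivity hypothesis at x = 19
-- shows that the digit list of C and the coefficientwise sum s = d + r
-- have the same value in base 19.  Both lists have entries < 19 and no
-- trailing zeros, so by uniqueness of base-19 representations the digits
-- of C are exactly s.  But s = d + reverse d reads the same backwards,
-- hence reversing the digits of C does not change its value: C = C*.

open import Defs
open import Data.Nat using (ℕ; zero; suc; _+_; _*_; _<_; _≤_; _>_; z≤n; s≤s)
open import Data.Nat.Properties
open import Data.Nat.DivMod using (_/_; _%_; m≡m%n+[m/n]*n; m%n<n; m/n<m)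
open import Data.Nat.Induction using (<-rec)
open import Data.Nat.Solver using (module +-*-Solver)
open +-*-Solver using (solve; _:+_; _:*_; _:=_)
open import Data.List using (List; []; _∷_; _∷ʳ_; zipWith; reverse; length)
open import Data.List.Properties using (unfold-reverse; length-reverse; reverse-involutive; zipWith-comm)
open import Data.List.Relation.Unary.All as All using (All; []; _∷_)
open import Data.List.Relation.Unary.All.Properties using (++⁺)
open import Data.Product using (_×_; _,_)
open import Data.Empty using (⊥-elim)
open import Relation.Binary.Definitions using (tri<; tri≈; tri>)
open import Relation.Binary.PropositionalEquality

⟦_⟧ : List ℕ → ℕ → ℕ
⟦ u ⟧ x = evalPoly u x

_⊕_ : List ℕ → List ℕ → List ℕ
_⊕_ = zipWith _+_

Below : ℕ → List ℕ → Set
Below B = All (_< B)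

eval-⊕ : ∀ u v → length u ≡ length v → ∀ x → ⟦ u ⊕ v ⟧ x ≡ ⟦ u ⟧ x + ⟦ v ⟧ x
eval-⊕ []      []      _   x = refl
eval-⊕ (a ∷ u) (b ∷ v) len x =
  trans (cong (λ t → a + b + x * t) (eval-⊕ u v (suc-injective len) x))
        (solve 5 (λ a b x p q → (a :+ b) :+ x :* (p :+ q) := (a :+ x :* p) :+ (b :+ x :* q))
               refl a b x (⟦ u ⟧ x) (⟦ v ⟧ x))

reverse-zipWith : (f : ℕ → ℕ → ℕ) → ∀ u v → length u ≡ length v →
                  reverse (zipWith f u v) ≡ zipWith f (reverse u) (reverse v)
reverse-zipWith f []      []      _   = refl
reverse-zipWith f (a ∷ u) (b ∷ v) len = begin
  reverse (f a b ∷ zipWith f u v)                  ≡⟨ unfold-reverse (f a b) (zipWith f u v) ⟩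
  reverse (zipWith f u v) ∷ʳ f a b                 ≡⟨ cong (_∷ʳ f a b) (reverse-zipWith f u v len′) ⟩
  zipWith f (reverse u) (reverse v) ∷ʳ f a b       ≡⟨ zipWith-∷ʳ (reverse u) (reverse v) lenRev ⟩
  zipWith f (reverse u ∷ʳ a) (reverse v ∷ʳ b)      ≡⟨ sym (cong₂ (zipWith f) (unfold-reverse a u) (unfold-reverse b v)) ⟩
  zipWith f (reverse (a ∷ u)) (reverse (b ∷ v))    ∎
  where
    open ≡-Reasoning
    len′ : length u ≡ length v
    len′ = suc-injective len
    lenRev : length (reverse u) ≡ length (reverse v)
    lenRev = trans (length-reverse u) (trans len′ (sym (length-reverse v)))
    zipWith-∷ʳ : ∀ p q → length p ≡ length q → zipWith f p q ∷ʳ f a b ≡ zipWith f (p ∷ʳ a) (q ∷ʳ b)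
    zipWith-∷ʳ []      []      _ = refl
    zipWith-∷ʳ (x ∷ p) (y ∷ q) l = cong (f x y ∷_) (zipWith-∷ʳ p q (suc-injective l))

⊕-reverse-palindrome : ∀ u → reverse (u ⊕ reverse u) ≡ u ⊕ reverse u
⊕-reverse-palindrome u = begin
  reverse (u ⊕ reverse u)               ≡⟨ reverse-zipWith _+_ u (reverse u) (sym (length-reverse u)) ⟩
  reverse u ⊕ reverse (reverse u)       ≡⟨ cong (reverse u ⊕_) (reverse-involutive u) ⟩
  reverse u ⊕ u                         ≡⟨ zipWith-comm _+_ +-comm (reverse u) u ⟩
  u ⊕ reverse u                         ∎
  where open ≡-Reasoning

Below-reverse : ∀ {B} u → Below B u → Below B (reverse u)
Below-reverse []      []         = []
Below-reverse (a ∷ u) (a<B ∷ u<B) rewrite unfold-reverse a u = ++⁺ (Below-reverse u u<B) (a<B ∷ [])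

Below-⊕ : ∀ u v → Below 10 u → Below 10 v → Below 19 (u ⊕ v)
Below-⊕ []      _       _             _             = []
Below-⊕ (_ ∷ _) []      _             _             = []
Below-⊕ (a ∷ u) (b ∷ v) (a<10 ∷ u<10) (b<10 ∷ v<10) =
  +-mono-<-≤ a<10 (≤-pred b<10) ∷ Below-⊕ u v u<10 v<10

-- A coefficient list is trimmed if it is empty or its last entry is nonzero.
data Trimmed : List ℕ → Set where
  empty  : Trimmed []
  top    : ∀ {c} → 0 < c → Trimmed (c ∷ [])
  extend : ∀ a {b u} → Trimmed (b ∷ u) → Trimmed (a ∷ b ∷ u)

Trimmed-tail : ∀ {a u} → Trimmed (a ∷ u) → Trimmed u
Trimmed-tail (top _)      = empty
Trimmed-tail (extend _ t) = t

Trimmed-cons : ∀ a u → Trimmed u → (u ≡ [] → 0 < a) → Trimmed (a ∷ u)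
Trimmed-cons a []      _ a>0 = top (a>0 refl)
Trimmed-cons a (_ ∷ _) t _   = extend a t

Trimmed-⊕ : ∀ u v → Trimmed u → length u ≡ length v → Trimmed (u ⊕ v)
Trimmed-⊕ []          []          empty        _   = empty
Trimmed-⊕ (c ∷ [])    (b ∷ [])    (top c>0)    _   = top (≤-trans c>0 (m≤m+n c b))
Trimmed-⊕ (a ∷ _ ∷ u) (b ∷ _ ∷ v) (extend _ t) len = extend (a + b) (Trimmed-⊕ _ _ t (suc-injective len))

Trimmed-positive : ∀ {B a u} → 0 < B → Trimmed (a ∷ u) → 0 < ⟦ a ∷ u ⟧ B
Trimmed-positive {B} {c}         _   (top c>0)    = ≤-trans c>0 (m≤m+n c (B * 0))
Trimmed-positive {B} {a} {b ∷ u} B>0 (extend _ t) =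
  ≤-trans (*-mono-≤ B>0 (Trimmed-positive B>0 t)) (m≤n+m (B * ⟦ b ∷ u ⟧ B) a)

quotient-dominates : ∀ B a b m k → a < B → m < k → a + B * m < b + B * k
quotient-dominates B a b m k a<B m<k = begin-strict
  a + B * m   <⟨ +-monoˡ-< (B * m) a<B ⟩
  B + B * m   ≡⟨ sym (*-suc B m) ⟩
  B * suc m   ≤⟨ *-monoʳ-≤ B m<k ⟩
  B * k       ≤⟨ m≤n+m (B * k) b ⟩
  b + B * k   ∎
  where open ≤-Reasoning

division-unique : ∀ B a b m k → a < B → b < B → a + B * m ≡ b + B * k → a ≡ b × m ≡ k
division-unique B a b m k a<B b<B eq with <-cmp m k
... | tri< m<k _ _  = ⊥-elim (<-irrefl eq (quotient-dominates B a b m k a<B m<k))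
... | tri> _ _ k<m  = ⊥-elim (<-irrefl (sym eq) (quotient-dominates B b a k m b<B k<m))
... | tri≈ _ refl _ = +-cancelʳ-≡ (B * m) a b eq , refl

representation-unique : ∀ B u v → Below B u → Below B v → Trimmed u → Trimmed v →
                        ⟦ u ⟧ B ≡ ⟦ v ⟧ B → u ≡ v
representation-unique B []      []      _ _ _ _ _ = refl
representation-unique B []      (b ∷ v) _ (b<B ∷ _) _ tv eq =
  ⊥-elim (<-irrefl eq (Trimmed-positive (≤-trans (s≤s z≤n) b<B) tv))
representation-unique B (a ∷ u) []      (a<B ∷ _) _ tu _ eq =
  ⊥-elim (<-irrefl (sym eq) (Trimmed-positive (≤-trans (s≤s z≤n) a<B) tu))
representation-unique B (a ∷ u) (b ∷ v) (a<B ∷ u<B) (b<B ∷ v<B) tu tv eq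
  with division-unique B a b (⟦ u ⟧ B) (⟦ v ⟧ B) a<B b<B eq
... | refl , rest = cong (a ∷_) (representation-unique B u v u<B v<B (Trimmed-tail tu) (Trimmed-tail tv) rest)

quotient-smaller : ∀ n → suc n / 10 < suc n
quotient-smaller n = m/n<m (suc n) 10 (s≤s (s≤s z≤n))

digitsAux-fuel : ∀ f g n → n ≤ f → n ≤ g → digitsAux f n ≡ digitsAux g n
digitsAux-fuel zero    zero    zero    _ _ = refl
digitsAux-fuel zero    (suc g) zero    _ _ = refl
digitsAux-fuel (suc f) zero    zero    _ _ = refl
digitsAux-fuel (suc f) (suc g) zero    _ _ = refl
digitsAux-fuel (suc f) (suc g) (suc n) n<f n<g =
  cong (suc n % 10 ∷_) (digitsAux-fuel f g (suc n / 10) (below f n<f) (below g n<g))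
  where
    below : ∀ h → suc n ≤ suc h → suc n / 10 ≤ h
    below h n<h = ≤-pred (≤-trans (quotient-smaller n) n<h)

digits-suc : ∀ n → digits (suc n) ≡ suc n % 10 ∷ digits (suc n / 10)
digits-suc n = cong (suc n % 10 ∷_)
  (digitsAux-fuel n (suc n / 10) (suc n / 10) (≤-pred (quotient-smaller n)) ≤-refl)

digits-ind : (Q : ℕ → List ℕ → Set) → Q 0 [] →
             (∀ n → Q (suc n / 10) (digits (suc n / 10)) → Q (suc n) (suc n % 10 ∷ digits (suc n / 10))) →
             ∀ n → Q n (digits n)
digits-ind Q base step = <-rec (λ n → Q n (digits n)) go
  where
    go : ∀ n → (∀ {m} → m < n → Q m (digits m)) → Q n (digits n)
    go zero    _  = base
    go (suc n) ih = subst (Q (suc n)) (sym (digits-suc n)) (step n (ih (quotient-smaller n)))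

-- Division by 10 written in the form used by Horner evaluation.
division-by-10 : ∀ n → n % 10 + 10 * (n / 10) ≡ n
division-by-10 n = trans (cong (n % 10 +_) (*-comm 10 (n / 10))) (sym (m≡m%n+[m/n]*n n 10))

digits-value : ∀ n → ⟦ digits n ⟧ 10 ≡ n
digits-value = digits-ind (λ n u → ⟦ u ⟧ 10 ≡ n) refl
  (λ n ih → trans (cong (λ t → suc n % 10 + 10 * t) ih) (division-by-10 (suc n)))

digits-below : ∀ n → Below 10 (digits n)
digits-below = digits-ind (λ _ u → Below 10 u) [] (λ n ih → m%n<n (suc n) 10 ∷ ih)

digits-trimmed : ∀ n → Trimmed (digits n)
digits-trimmed = digits-ind (λ _ u → Trimmed u) empty
  (λ n ih → Trimmed-cons (suc n % 10) (digits (suc n / 10)) ih (last-digit-positive n))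
  where
    -- If the quotient has no digits it is 0, so the last digit is the whole number.
    last-digit-positive : ∀ n → digits (suc n / 10) ≡ [] → 0 < suc n % 10
    last-digit-positive n none = subst (0 <_) (sym last≡n) (s≤s z≤n)
      where
        quotient≡0 : suc n / 10 ≡ 0
        quotient≡0 = trans (sym (digits-value (suc n / 10))) (cong (λ u → ⟦ u ⟧ 10) none)
        last≡n : suc n % 10 ≡ suc n
        last≡n = trans (sym (+-identityʳ (suc n % 10)))
                       (trans (cong (λ t → suc n % 10 + 10 * t) (sym quotient≡0)) (division-by-10 (suc n)))

digits-prepend : ∀ a m n → a < 10 → a + 10 * m ≡ suc n → digits (suc n) ≡ a ∷ digits m
digits-prepend a m n a<10 eq with division-unique 10 (suc n % 10) a (suc n / 10) m
                                    (m%n<n (suc n) 10) a<10 (trans (division-by-10 (suc n)) (sym eq))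
... | last≡a , quotient≡m = trans (digits-suc n) (cong₂ (λ x m → x ∷ digits m) last≡a quotient≡m)

P-of-digit-list : ∀ u → Below 10 u → ∀ x → P (⟦ u ⟧ 10) x ≡ ⟦ u ⟧ x
P-of-digit-list []      []            x = refl
P-of-digit-list (a ∷ u) (a<10 ∷ u<10) x with a + 10 * ⟦ u ⟧ 10 in eq
... | zero  = sym (trans (cong₂ (λ a t → a + x * t) (m+n≡0⇒m≡0 a eq) tail≡0) (*-zeroʳ x))
  where
    value≡0 : ⟦ u ⟧ 10 ≡ 0
    value≡0 = m*n≡0⇒m≡0 (⟦ u ⟧ 10) 10 (trans (*-comm (⟦ u ⟧ 10) 10) (m+n≡0⇒n≡0 a eq))
    tail≡0 : ⟦ u ⟧ x ≡ 0
    tail≡0 = trans (sym (P-of-digit-list u u<10 x)) (cong (λ m → P m x) value≡0)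
... | suc n = trans (cong (λ ds → ⟦ ds ⟧ x) (digits-prepend a (⟦ u ⟧ 10) n a<10 eq))
                    (cong (λ t → a + x * t) (P-of-digit-list u u<10 x))

additive-digits : ∀ A → AdditivePair A (rev A) →
                  digits (A + rev A) ≡ digits A ⊕ reverse (digits A)
additive-digits A additive =
  representation-unique 19 (digits C) (d ⊕ r)
    (All.map (λ c<10 → ≤-trans c<10 (m≤m+n 10 9)) (digits-below C))
    (Below-⊕ d r d<10 r<10)
    (digits-trimmed C)
    (Trimmed-⊕ d r (digits-trimmed A) (sym (length-reverse d)))
    value-at-19
  where
    open ≡-Reasoning
    d r : List ℕ
    d = digits A
    r = reverse d
    C : ℕ
    C = A + rev A
    d<10 : Below 10 d
    d<10 = digits-below A
    r<10 : Below 10 r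
    r<10 = Below-reverse d d<10
    value-at-19 : ⟦ digits C ⟧ 19 ≡ ⟦ d ⊕ r ⟧ 19
    value-at-19 = begin
      P C 19                 ≡⟨ sym (additive 19) ⟩
      P A 19 + P (rev A) 19  ≡⟨ cong (⟦ d ⟧ 19 +_) (P-of-digit-list r r<10 19) ⟩
      ⟦ d ⟧ 19 + ⟦ r ⟧ 19    ≡⟨ sym (eval-⊕ d r (sym (length-reverse d)) 19) ⟩
      ⟦ d ⊕ r ⟧ 19           ∎

-- Proposition 18: if (A, A*) is an additive pair, then A + A* is a palindrome.
proposition18 : (A : ℕ) → A > 0 → AdditivePair A (rev A) → IsPalindrome (A + rev A)
proposition18 A _ additive = begin
  C                                   ≡⟨ sym (digits-value C) ⟩
  ⟦ digits C ⟧ 10                     ≡⟨ cong (λ u → ⟦ u ⟧ 10) (sym digits-palindromic) ⟩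
  ⟦ reverse (digits C) ⟧ 10           ∎
  where
    open ≡-Reasoning
    C : ℕ
    C = A + rev A
    digits-palindromic : reverse (digits C) ≡ digits C
    digits-palindromic rewrite additive-digits A additive = ⊕-reverse-palindrome (digits A)
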